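{- For every $k\in\mathbb N$, the $k$-th standard Fibonacci-like partition of the first kind $\mathfrak P_k$ is a partition of $\mathbb N$ into $F(k)$ parts. Explicitly: $\mathfrak P_1=\mathfrak P_2$ consist of the single part $\mathbb N$, and for $k\geq 3$, with $i=k-3$, the $F(k)$ sets $$R_{i,0},R_{i,1},\ldots,R_{i,F(i+2)-1},\;R_{i+1,0},R_{i+1,1},\ldots,R_{i+1,F(i+1)-1}$$ are pairwise disjoint and their union is $\mathbb N$.
   Context: Let $\varphi=\frac{1+\sqrt5}{2}$ and $\mathbb N=\{1,2,3,\dots\}$. For $n\in\mathbb N$ put $a(n)=\lfloor n\varphi\rfloor$. $F$ denotes the Fibonacci sequence, $F(0)=0$, $F(1)=F(2)=1$, $F(n)=F(n-1)+F(n-2)$. For $i\in\mathbb Z^{\geq 0}$ and $j\in\mathbb Z$ define $f_{i,j}(n)=F(i+1)a(n)+F(i)n-j$ for $n\in\mathbb N$, and $R_{i,j}=\{f_{i,j}(n)\mid n\in\mathbb N\}$. For $k\geq 3$ the $k$-th standard Fibonacci-like partition of the first kind is $\mathfrak P_k=\{R_{i,0},\ldots,R_{i,F(i+2)-1},R_{i+1,0},\ldots,R_{i+1,F(i+1)-1}\}$ with $i=k-3$; and $\mathfrak P_1=\mathfrak P_2$ is the trivial partition with the single part $\mathbb N$. -}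

module Defs where

open import Data.Nat as ℕ using (ℕ; zero; suc; _*_; _∸_; _≤?_; _<?_)
open import Data.Bool using (Bool; true; false; if_then_else_)
open import Data.Fin using (Fin; toℕ)
open import Data.Integer as ℤ using (ℤ; +_)
open import Data.Product using (Σ; ∃; _×_; _,_)
open import Relation.Nullary using (yes; no)
open import Relation.Nullary.Decidable using (⌊_⌋)
open import Relation.Binary.PropositionalEquality using (_≡_)

F : ℕ → ℕ
F zero = 0
F (suc zero) = 1
F (suc (suc n)) = F (suc n) ℕ.+ F n

-- largest P N : the largest m ≤ N with P m (0 if none).
largest : (ℕ → Bool) → ℕ → ℕ
largest P zero = 0
largest P (suc N) = if P (suc N) then suc N else largest P N

-- For m, n : ℕ with n ≥ 1 :  m ≤ n·φ  ⇔  m² ≤ m·n + n²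
-- (φ is the positive root of x² = x + 1, the other root is negative).
-- Since n·φ < 2n, ⌊nφ⌋ is the largest m ≤ 2n with m² ≤ m·n + n².
a : ℕ → ℕ
a n = largest (λ m → ⌊ m * m ≤? m * n ℕ.+ n * n ⌋) (2 * n)

f : ℕ → ℤ → ℕ → ℤ
f i j n = (+ (F (suc i) * a n ℕ.+ F i * n)) ℤ.- j

R : ℕ → ℤ → ℤ → Set
R i j x = Σ ℕ λ n → (1 ℕ.≤ n) × (x ≡ f i j n)

-- ℕ = {1,2,3,...} viewed as a subset of ℤ
Pos : ℤ → Set
Pos x = + 1 ℤ.≤ x

Part : (k : ℕ) → Fin (F k) → ℤ → Set
Part zero () x
Part (suc zero) t x = Pos x
Part (suc (suc zero)) t x = Pos x
Part (suc (suc (suc i))) t x with toℕ t <? F (suc (suc i))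
... | yes _ = R i (+ toℕ t) x
... | no _ = R (suc i) (+ (toℕ t ∸ F (suc (suc i)))) x

IsPartitionOfℕ : {m : ℕ} → (Fin m → ℤ → Set) → Set
IsPartitionOfℕ {m} P =
  ((t : Fin m) → ∃ λ x → P t x)
  × ((t : Fin m) (x : ℤ) → P t x → Pos x)
  × ((t u : Fin m) (x : ℤ) → P t x → P u x → t ≡ u)
  × ((x : ℤ) → Pos x → ∃ λ t → P t x)

-- Write a(n) = ⌊nφ⌋ and b(n) = a(n) + n = ⌊nφ²⌋.  By Beatty's theorem a and b enumerate
-- complementary subsets of ℕ, and a(a(n)) = b(n) − 1, a(b(n)) = a(n) + b(n).  Substituting
-- these into f gives f_{i,j}(a(n)) = f_{i+1,F(i+1)+j}(n) and f_{i,j}(b(n)) = f_{i+2,j}(n), so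
-- R_{i,j} is the disjoint union of R_{i+1,F(i+1)+j} and R_{i+2,j}.  Splitting the parts
-- R_{i,0},…,R_{i,F(i+2)−1} of 𝔓_k in this way and keeping R_{i+1,0},…,R_{i+1,F(i+1)−1} gives
-- 𝔓_{k+1}, so the theorem follows by induction from 𝔓_3 = {a(ℕ), b(ℕ)}.  Everything about φ
-- is reduced to arithmetic in ℕ through m ≤ nφ ⇔ m² ≤ mn + n², with strictness coming from
-- the irrationality of φ: m² = mn + n² has no solution with n ≥ 1.

module Submission where

open import Defs
open import Data.Bool using (Bool; true; false; T)
open import Data.Empty using (⊥; ⊥-elim)
open import Function using (_∘_)
open import Data.Nat
  using (ℕ; zero; suc; _+_; _*_; _∸_; _≤_; _<_; _≤?_; z≤n; s≤s; s≤s⁻¹; >-nonZero)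
open import Data.Nat.Properties
open import Data.Nat.Induction using (<-rec)
open import Data.Nat.Tactic.RingSolver using (solve-∀)
open import Data.Product using (∃; _×_; _,_)
open import Data.Integer as ℤ using (ℤ; +_; _⊖_; +≤+)
import Data.Integer.Properties as ℤP
open import Algebra.Properties.AbelianGroup ℤP.+-0-abelianGroup using (∙-cancelʳ)
open import Data.Fin using (Fin; zero; toℕ; fromℕ<)
open import Data.Fin.Properties using (toℕ<n; toℕ-fromℕ<; toℕ-injective)
open import Data.Sum using (_⊎_; inj₁; inj₂)
open import Relation.Nullary using (¬_; Dec; yes; no; contradiction)
open import Relation.Nullary.Decidable using (⌊_⌋; map′; toWitness; fromWitness)
open import Relation.Unary using (Decidable)
open import Relation.Binary.PropositionalEquality
  using (_≡_; _≢_; refl; sym; trans; cong; cong₂; subst; module ≡-Reasoning)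

module _ (p : ℕ → Bool) where

  largest-satisfies : T (p 0) → ∀ N → T (p (largest p N))
  largest-satisfies p0 zero = p0
  largest-satisfies p0 (suc N) with p (suc N) in eq
  ... | true = subst T (sym eq) _
  ... | false = largest-satisfies p0 N

  largest-maximal : ∀ {m} N → m ≤ N → T (p m) → m ≤ largest p N
  largest-maximal zero z≤n _ = z≤n
  largest-maximal (suc N) m≤N pm with p (suc N) in eq
  ... | true = m≤N
  ... | false with m≤n⇒m<n∨m≡n m≤N
  ...   | inj₁ m<N = largest-maximal N (s≤s⁻¹ m<N) pm
  ...   | inj₂ refl = contradiction (subst T eq pm) λ ()

m+n≢o : ∀ {m n o} → o < m → m + n ≢ o
m+n≢o o<m e = <⇒≱ o<m (subst (_ ≤_) e (m≤m+n _ _))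

crossing : ∀ {p} {P : ℕ → Set p} → Decidable P → ¬ P 0 →
           ∀ {n} → P n → ∃ λ m → ¬ P m × P (suc m)
crossing P? ¬P0 {zero} P0 = contradiction P0 ¬P0
crossing P? ¬P0 {suc n} P1+n with P? n
... | yes Pn = crossing P? ¬P0 Pn
... | no ¬Pn = n , ¬Pn , P1+n

infix 4 _≤φ_ _≤φ?_

-- m ≤φ n encodes m ≤ φ n as in the definition of a; a record keeps m and n inferable.
record _≤φ_ (m n : ℕ) : Set where
  constructor sq≤⇒≤φ
  field ≤φ⇒sq≤ : m * m ≤ m * n + n * n
open _≤φ_

_≤φ?_ : ∀ m n → Dec (m ≤φ n)
m ≤φ? n = map′ sq≤⇒≤φ ≤φ⇒sq≤ (m * m ≤? m * n + n * n)

≤φ⇒*∸≤ : ∀ {m n} → m ≤φ n → m * (m ∸ n) ≤ n * n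
≤φ⇒*∸≤ {m} {n} p =
  subst (_≤ n * n) (sym (*-distribˡ-∸ m m n)) (m≤n+o⇒m∸n≤o (m * m) (m * n) (≤φ⇒sq≤ p))

*∸≤⇒≤φ : ∀ {m n} → m * (m ∸ n) ≤ n * n → m ≤φ n
*∸≤⇒≤φ {m} {n} p = sq≤⇒≤φ (≤-trans (m≤n+m∸n (m * m) (m * n))
  (+-monoʳ-≤ (m * n) (subst (_≤ n * n) (*-distribˡ-∸ m m n) p)))

≤φ-refl : ∀ n → n ≤φ n
≤φ-refl n = sq≤⇒≤φ (m≤m+n (n * n) (n * n))

≤φ-antimonoˡ : ∀ {m m′ n} → m ≤ m′ → m′ ≤φ n → m ≤φ n
≤φ-antimonoˡ {n = n} m≤m′ p = *∸≤⇒≤φ (≤-trans (*-mono-≤ m≤m′ (∸-monoˡ-≤ n m≤m′)) (≤φ⇒*∸≤ p))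

≤φ-monoʳ : ∀ {m n n′} → n ≤ n′ → m ≤φ n → m ≤φ n′
≤φ-monoʳ {m} n≤n′ p =
  *∸≤⇒≤φ (≤-trans (*-monoʳ-≤ m (∸-monoʳ-≤ m n≤n′)) (≤-trans (≤φ⇒*∸≤ p) (*-mono-≤ n≤n′ n≤n′)))

≤φ⇒∸≤ : ∀ {m n} → m ≤φ n → m ∸ n ≤ n
≤φ⇒∸≤ {m} {n} p with m ≤? n
... | yes m≤n = ≤-trans (≤-reflexive (m≤n⇒m∸n≡0 m≤n)) z≤n
... | no m≰n = *-cancelˡ-≤ m {{>-nonZero (≤-<-trans z≤n n<m)}}
                 (≤-trans (≤φ⇒*∸≤ p) (*-monoˡ-≤ n (<⇒≤ n<m)))
  where n<m = ≰⇒> m≰n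

≤φ-suc : ∀ {m n} → m ≤φ n → suc m ≤φ suc n
≤φ-suc {m} {n} p = *∸≤⇒≤φ (begin
  (m ∸ n) + m * (m ∸ n)  ≤⟨ +-mono-≤ (≤φ⇒∸≤ p) (≤φ⇒*∸≤ p) ⟩
  n + n * n              ≤⟨ +-monoʳ-≤ n (*-monoʳ-≤ n (n≤1+n n)) ⟩
  n + n * suc n          <⟨ n<1+n _ ⟩
  suc n * suc n          ∎)
  where open ≤-Reasoning

-- Since φ − 1 = 1/φ, this identity turns x + y ≤ φx into φy ≤ x.
golden-shift : ∀ x y → (x + y) * (x + y) + x * x ≡ ((x + y) * x + x * x) + (x * y + y * y)
golden-shift = solve-∀

golden-descent : ∀ x y → (x + y) * (x + y) ≡ (x + y) * x + x * x → x * x ≡ x * y + y * y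
golden-descent x y e = +-cancelˡ-≡ ((x + y) * x + x * x) _ _ (begin
  ((x + y) * x + x * x) + x * x  ≡⟨ cong (_+ x * x) e ⟨
  (x + y) * (x + y) + x * x      ≡⟨ golden-shift x y ⟩
  ((x + y) * x + x * x) + (x * y + y * y) ∎)
  where open ≡-Reasoning

-- Infinite descent: a solution (n + d, n) yields the smaller solution (n, d).
φ-irrational : ∀ n m → 1 ≤ n → m * m ≢ m * n + n * n
φ-irrational = <-rec (λ n → ∀ m → 1 ≤ n → m * m ≢ m * n + n * n) descend
  where
  sq<φ : ∀ {m n} → m ≤ n → 1 ≤ n → m * m < m * n + n * n
  sq<φ {m} {n} m≤n n≥1 = ≤-<-trans (*-monoʳ-≤ m m≤n) (m<m+n (m * n) (*-mono-≤ n≥1 n≥1))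

  descend : ∀ n → (∀ {d} → d < n → ∀ m → 1 ≤ d → m * m ≢ m * d + d * d) →
            ∀ m → 1 ≤ n → m * m ≢ m * n + n * n
  descend n rec m n≥1 e with m ≤? n
  ... | yes m≤n = <-irrefl e (sq<φ m≤n n≥1)
  ... | no m≰n with m≤n⇒∃[o]m+o≡n (<⇒≤ (≰⇒> m≰n))
  ...   | zero , refl = m≰n (≤-reflexive (+-identityʳ n))
  ...   | suc d , refl with n ≤? suc d
  ...     | yes n≤d = <-irrefl (golden-descent n (suc d) e) (sq<φ n≤d (≤-trans n≥1 n≤d))
  ...     | no n≰d = rec (≰⇒> n≰d) n (s≤s z≤n) (golden-descent n (suc d) e)

≤φ-strict : ∀ {m n} → 1 ≤ n → m ≤φ n → m * m < m * n + n * n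
≤φ-strict {m} {n} n≥1 p = ≤∧≢⇒< (≤φ⇒sq≤ p) (φ-irrational n m n≥1)

+≤φ⇒≥ : ∀ {x y} → (x + y) ≤φ x → x * y + y * y ≤ x * x
+≤φ⇒≥ {x} {y} p = +-cancelˡ-≤ ((x + y) * x + x * x) _ _ (begin
  ((x + y) * x + x * x) + (x * y + y * y) ≡⟨ golden-shift x y ⟨
  (x + y) * (x + y) + x * x               ≤⟨ +-monoˡ-≤ (x * x) (≤φ⇒sq≤ p) ⟩
  ((x + y) * x + x * x) + x * x           ∎)
  where open ≤-Reasoning

≥⇒+≤φ : ∀ {x y} → x * y + y * y ≤ x * x → (x + y) ≤φ x
≥⇒+≤φ {x} {y} q = sq≤⇒≤φ (+-cancelʳ-≤ (x * x) _ _ (begin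
  (x + y) * (x + y) + x * x               ≡⟨ golden-shift x y ⟩
  ((x + y) * x + x * x) + (x * y + y * y) ≤⟨ +-monoʳ-≤ ((x + y) * x + x * x) q ⟩
  ((x + y) * x + x * x) + x * x           ∎))
  where open ≤-Reasoning

+≤φ⇒≰φ : ∀ {x y} → 1 ≤ y → (x + y) ≤φ x → ¬ x ≤φ y
+≤φ⇒≰φ y≥1 p q = <⇒≱ (≤φ-strict y≥1 q) (+≤φ⇒≥ p)

≰φ⇒+≤φ : ∀ {x y} → ¬ x ≤φ y → (x + y) ≤φ x
≰φ⇒+≤φ x≰φy = ≥⇒+≤φ (<⇒≤ (≰⇒> (x≰φy ∘ sq≤⇒≤φ)))

+≰φ⇒≤φ : ∀ {x y} → ¬ (x + y) ≤φ x → x ≤φ y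
+≰φ⇒≤φ p = sq≤⇒≤φ (<⇒≤ (≰⇒> (p ∘ ≥⇒+≤φ)))

a-≤φ : ∀ n → a n ≤φ n
a-≤φ n = sq≤⇒≤φ (toWitness (largest-satisfies (λ m → ⌊ m * m ≤? m * n + n * n ⌋) 0-satisfies (2 * n)))
  where
  0-satisfies = fromWitness {a? = 0 * 0 ≤? 0 * n + n * n} z≤n

≤φ⇒≤a : ∀ {m n} → m ≤φ n → m ≤ a n
≤φ⇒≤a {m} {n} p =
  largest-maximal (λ m → ⌊ m * m ≤? m * n + n * n ⌋) (2 * n) m≤2n (fromWitness (≤φ⇒sq≤ p))
  where
  m≤2n : m ≤ 2 * n
  m≤2n = ≤-trans (m≤n+m∸n m n)
                 (+-monoʳ-≤ n (≤-trans (≤φ⇒∸≤ p) (≤-reflexive (sym (+-identityʳ n)))))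

a-unique : ∀ {m n} → m ≤φ n → ¬ suc m ≤φ n → a n ≡ m
a-unique {n = n} p q = ≤-antisym (≮⇒≥ λ m<an → q (≤φ-antimonoˡ m<an (a-≤φ n))) (≤φ⇒≤a p)

1+a≰φ : ∀ n → ¬ suc (a n) ≤φ n
1+a≰φ n p = <-irrefl refl (≤φ⇒≤a p)

a-<-suc : ∀ n → a n < a (suc n)
a-<-suc n = ≤φ⇒≤a (≤φ-suc (a-≤φ n))

n≤a : ∀ n → n ≤ a n
n≤a n = ≤φ⇒≤a (≤φ-refl n)

a-strictMono : ∀ {m n} → m < n → a m < a n
a-strictMono {m} {suc n} (s≤s m≤n) with m≤n⇒m<n∨m≡n m≤n
... | inj₁ m<n = <-trans (a-strictMono m<n) (a-<-suc n)
... | inj₂ refl = a-<-suc m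

b : ℕ → ℕ
b n = a n + n

a∘a : ∀ n → a (a (suc n)) ≡ a (suc n) + n
a∘a n = a-unique (≰φ⇒+≤φ λ p → <⇒≱ (a-<-suc n) (≤φ⇒≤a p))
                 (λ p → +≤φ⇒≰φ (s≤s z≤n) (subst (_≤φ A) (sym (+-suc A n)) p) (a-≤φ (suc n)))
  where A = a (suc n)

a∘b : ∀ n → a (b n) ≡ b n + a n
a∘b zero = refl
a∘b (suc n) = a-unique (≰φ⇒+≤φ λ p → +≤φ⇒≰φ (s≤s z≤n) p (a-≤φ (suc n)))
                       (λ p → +≤φ⇒≰φ (s≤s z≤n) (subst (_≤φ B) (sym (+-suc B A)) p) B≤φ1+A)
  where
  A = a (suc n)
  B = A + suc n
  B≤φ1+A : B ≤φ suc A
  B≤φ1+A = ≤φ-antimonoˡ (n≤1+n B) (≰φ⇒+≤φ (1+a≰φ (suc n)))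

-- With φn < x ≤ φ(n + 1): x = a(n + 1), unless also x + 1 ≤ φ(n + 1), and then x = b(x − n).
beatty-cover : ∀ {x} → 1 ≤ x → (∃ λ n → 1 ≤ n × a n ≡ x) ⊎ (∃ λ m → 1 ≤ m × b m ≡ x)
beatty-cover {x} x≥1 with crossing (x ≤φ?_) (λ p → <⇒≱ x≥1 (≤φ⇒∸≤ p)) (≤φ-refl x)
... | n , x≰φn , x≤φ1+n with suc x ≤φ? suc n
...   | no 1+x≰φ1+n = inj₁ (suc n , s≤s z≤n , a-unique x≤φ1+n 1+x≰φ1+n)
...   | yes 1+x≤φ1+n with m≤n⇒∃[o]m+o≡n (≰⇒≥ λ x≤n → x≰φn (≤φ-monoʳ x≤n (≤φ-refl x)))
...     | zero , refl = ⊥-elim (x≰φn (subst (_≤φ n) (sym (+-identityʳ n)) (≤φ-refl n)))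
...     | suc m , refl =
  inj₂ (suc m , s≤s z≤n ,
        cong (_+ suc m) (a-unique (+≰φ⇒≤φ x≰φn) (+≤φ⇒≰φ (s≤s z≤n) 1+x≤φ1+n)))

beatty-disjoint : ∀ n {m} → 1 ≤ m → a n ≢ b m
beatty-disjoint n {m} m≥1 e = 1+a≰φ n (subst (λ z → suc z ≤φ n) (sym e) 1+A+m≤φn)
  where
  A = a m
  A+m≤φn : (A + m) ≤φ n
  A+m≤φn = subst (_≤φ n) e (a-≤φ n)
  A<n : A < n
  A<n = ≰⇒> λ n≤A → +≤φ⇒≰φ m≥1 (≤φ-monoʳ n≤A A+m≤φn) (a-≤φ m)
  1+A+m≤φn : suc (A + m) ≤φ n
  1+A+m≤φn = ≤φ-monoʳ A<n (≰φ⇒+≤φ (1+a≰φ m))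

F-pos : ∀ i → 1 ≤ F (1 + i)
F-pos zero = s≤s z≤n
F-pos (suc i) = ≤-trans (F-pos i) (m≤m+n _ _)

f₀ : ℕ → ℕ → ℕ
f₀ i n = F (1 + i) * a n + F i * n

f≡f₀⊖ : ∀ i j n → f i (+ j) n ≡ f₀ i n ⊖ j
f≡f₀⊖ i j n = ℤP.m-n≡m⊖n (f₀ i n) j

f₀-≥ : ∀ i {n} → 1 ≤ n → F (2 + i) ≤ f₀ i n
f₀-≥ i {n} n≥1 = begin
  F (1 + i) + F i          ≡⟨ cong₂ _+_ (*-identityʳ (F (1 + i))) (*-identityʳ (F i)) ⟨
  F (1 + i) * 1 + F i * 1  ≤⟨ +-mono-≤ (*-monoʳ-≤ (F (1 + i)) (≤-trans n≥1 (n≤a n)))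
                                       (*-monoʳ-≤ (F i) n≥1) ⟩
  f₀ i n                   ∎
  where open ≤-Reasoning

f₀-strictMono : ∀ i {m n} → m < n → f₀ i m < f₀ i n
f₀-strictMono i m<n = +-mono-<-≤ (*-monoʳ-< (F (1 + i)) {{>-nonZero (F-pos i)}} (a-strictMono m<n))
                                 (*-monoʳ-≤ (F i) (<⇒≤ m<n))

f₀-injective : ∀ i {m n} → f₀ i m ≡ f₀ i n → m ≡ n
f₀-injective i e = ≤-antisym (≮⇒≥ λ n<m → <-irrefl (sym e) (f₀-strictMono i n<m))
                             (≮⇒≥ λ m<n → <-irrefl e (f₀-strictMono i m<n))

f-injective : ∀ i j {m n} → f i j m ≡ f i j n → m ≡ n
f-injective i j e = f₀-injective i (ℤP.+-injective (∙-cancelʳ (ℤ.- j) _ _ e))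

f₀∘a : ∀ i n → F (1 + i) + f₀ i (a (suc n)) ≡ f₀ (1 + i) (suc n)
f₀∘a i n = begin
  F (1 + i) + (F (1 + i) * a A + F i * A)
    ≡⟨ cong (λ z → F (1 + i) + (F (1 + i) * z + F i * A)) (a∘a n) ⟩
  F (1 + i) + (F (1 + i) * (A + n) + F i * A)
    ≡⟨ identity (F (1 + i)) (F i) A n ⟩
  (F (1 + i) + F i) * A + F (1 + i) * suc n ∎
  where
  open ≡-Reasoning
  A = a (suc n)
  identity : ∀ p q A n → p + (p * (A + n) + q * A) ≡ (p + q) * A + p * suc n
  identity = solve-∀

f₀∘b : ∀ i n → f₀ i (b n) ≡ f₀ (2 + i) n
f₀∘b i n = begin
  F (1 + i) * a (A + n) + F i * (A + n)
    ≡⟨ cong (λ z → F (1 + i) * z + F i * (A + n)) (a∘b n) ⟩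
  F (1 + i) * ((A + n) + A) + F i * (A + n)
    ≡⟨ identity (F (1 + i)) (F i) A n ⟩
  ((F (1 + i) + F i) + F (1 + i)) * A + (F (1 + i) + F i) * n ∎
  where
  open ≡-Reasoning
  A = a n
  identity : ∀ p q A n → p * ((A + n) + A) + q * (A + n) ≡ ((p + q) + p) * A + (p + q) * n
  identity = solve-∀

f∘a : ∀ i j n → f i (+ j) (a (suc n)) ≡ f (1 + i) (+ (F (1 + i) + j)) (suc n)
f∘a i j n = begin
  f i (+ j) (a (suc n))                             ≡⟨ f≡f₀⊖ i j A ⟩
  f₀ i A ⊖ j                                        ≡⟨ ℤP.+-cancelˡ-⊖ (F (1 + i)) (f₀ i A) j ⟨
  (F (1 + i) + f₀ i A) ⊖ (F (1 + i) + j)            ≡⟨ cong (_⊖ (F (1 + i) + j)) (f₀∘a i n) ⟩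
  f₀ (1 + i) (suc n) ⊖ (F (1 + i) + j)              ≡⟨ f≡f₀⊖ (1 + i) (F (1 + i) + j) (suc n) ⟨
  f (1 + i) (+ (F (1 + i) + j)) (suc n)             ∎
  where
  open ≡-Reasoning
  A = a (suc n)

f∘b : ∀ i j n → f i j (b n) ≡ f (2 + i) j n
f∘b i j n = cong (λ z → + z ℤ.- j) (f₀∘b i n)

Pos-⊖ : ∀ {m n} → n < m → Pos (m ⊖ n)
Pos-⊖ n<m = subst Pos (sym (ℤP.⊖-≥ (<⇒≤ n<m))) (+≤+ (m<n⇒0<n∸m n<m))

R-pos : ∀ i j {x} → j < F (2 + i) → R i (+ j) x → Pos x
R-pos i j j<F (n , n≥1 , refl) =
  subst Pos (sym (f≡f₀⊖ i j n)) (Pos-⊖ (≤-trans j<F (f₀-≥ i n≥1)))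

R-lower⊆R : ∀ i j {x} → R (1 + i) (+ (F (1 + i) + j)) x → R i (+ j) x
R-lower⊆R i j (suc n , _ , refl) = a (suc n) , ≤-trans (s≤s z≤n) (n≤a (suc n)) , sym (f∘a i j n)

R-upper⊆R : ∀ i j {x} → R (2 + i) j x → R i j x
R-upper⊆R i j (n , n≥1 , refl) = b n , ≤-trans n≥1 (m≤n+m n (a n)) , sym (f∘b i j n)

R-split : ∀ i j {x} → R i (+ j) x → R (1 + i) (+ (F (1 + i) + j)) x ⊎ R (2 + i) (+ j) x
R-split i j (n , n≥1 , refl) with beatty-cover n≥1
... | inj₁ (suc m , _ , refl) = inj₁ (suc m , s≤s z≤n , f∘a i j m)
... | inj₂ (m , m≥1 , refl) = inj₂ (m , m≥1 , f∘b i (+ j) m)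

R-split-disjoint : ∀ i j {x} → R (1 + i) (+ (F (1 + i) + j)) x → R (2 + i) (+ j) x → ⊥
R-split-disjoint i j (suc n , _ , refl) (m , m≥1 , e) =
  beatty-disjoint (suc n) m≥1
    (f-injective i (+ j) (trans (f∘a i j n) (trans e (sym (f∘b i (+ j) m)))))

-- Block i t is the t-th part of 𝔓_{i+3}, i.e. Part (3 + i) with the index taken in ℕ.
data Block (i : ℕ) : ℕ → ℤ → Set where
  low  : ∀ {t x} → t < F (2 + i) → R i (+ t) x → Block i t x
  high : ∀ {s x} → R (1 + i) (+ s) x → Block i (F (2 + i) + s) x

Block-low : ∀ {i t x} → t < F (2 + i) → Block i t x → R i (+ t) x
Block-low _ (low _ r) = r
Block-low t<F (high _) = contradiction refl (m+n≢o t<F)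

Block-high : ∀ {i t x} → ¬ t < F (2 + i) → Block i t x → R (1 + i) (+ (t ∸ F (2 + i))) x
Block-high t≮F (low t<F _) = contradiction t<F t≮F
Block-high {i} _ (high {s} r) = subst (λ k → R (1 + i) (+ k) _) (sym (m+n∸m≡n (F (2 + i)) s)) r

Part⇒Block : ∀ i (t : Fin (F (3 + i))) {x} → Part (3 + i) t x → Block i (toℕ t) x
Part⇒Block i t p with toℕ t <? F (2 + i)
... | yes t<F = low t<F p
... | no t≮F = subst (λ u → Block i u _) (m+[n∸m]≡n (≮⇒≥ t≮F)) (high p)

Block⇒Part : ∀ i (t : Fin (F (3 + i))) {x} → Block i (toℕ t) x → Part (3 + i) t x
Block⇒Part i t b with toℕ t <? F (2 + i)
... | yes t<F = Block-low t<F b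
... | no t≮F = Block-high t≮F b

Block-pos : ∀ i {t x} → t < F (3 + i) → Block i t x → Pos x
Block-pos i {t} _ (low t<F r) = R-pos i t t<F r
Block-pos i t<F (high {s} r) =
  R-pos (1 + i) s (≤-trans (+-cancelˡ-< (F (2 + i)) _ _ t<F) (m≤n+m _ _)) r

Covers : ℕ → Set
Covers i = ∀ {x} → Pos x → ∃ λ t → t < F (3 + i) × Block i t x

Disjoint : ℕ → Set
Disjoint i = ∀ {t u x} → t < F (3 + i) → u < F (3 + i) → Block i t x → Block i u x → t ≡ u

-- Child i x u t: x lies in the u-th part of 𝔓_{i+4}, which is contained in the
-- t-th part of 𝔓_{i+3}.  The part R_{i+1,s} is kept, and R_{i,j} splits into
-- R_{i+1,F(i+1)+j} and R_{i+2,j}.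
data Child (i : ℕ) (x : ℤ) : ℕ → ℕ → Set where
  kept  : ∀ {s} → s < F (1 + i) → R (1 + i) (+ s) x → Child i x s (F (2 + i) + s)
  lower : ∀ {j} → j < F (2 + i) → R (1 + i) (+ (F (1 + i) + j)) x → Child i x (F (1 + i) + j) j
  upper : ∀ {j} → j < F (2 + i) → R (2 + i) (+ j) x → Child i x (F (3 + i) + j) j

Child⇒child : ∀ {i x u t} → Child i x u t → u < F (4 + i) × Block (1 + i) u x
Child⇒child {i} (kept {s} s<F r) = ≤-trans s<F′ (m≤m+n (F (3 + i)) (F (2 + i))) , low s<F′ r
  where
  s<F′ : s < F (3 + i)
  s<F′ = ≤-trans s<F (m≤n+m (F (1 + i)) (F (2 + i)))
Child⇒child {i} (lower {j} j<F r) = ≤-trans k<F (m≤m+n (F (3 + i)) (F (2 + i))) , low k<F r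
  where
  k<F : F (1 + i) + j < F (3 + i)
  k<F = subst (F (1 + i) + j <_) (+-comm (F (1 + i)) (F (2 + i))) (+-monoʳ-< (F (1 + i)) j<F)
Child⇒child {i} (upper j<F r) = +-monoʳ-< (F (3 + i)) j<F , high r

Child⇒parent : ∀ {i x u t} → Child i x u t → t < F (3 + i) × Block i t x
Child⇒parent {i} (kept s<F r) = +-monoʳ-< (F (2 + i)) s<F , high r
Child⇒parent {i} (lower {j} j<F r) = ≤-trans j<F (m≤m+n _ _) , low j<F (R-lower⊆R i j r)
Child⇒parent {i} (upper {j} j<F r) = ≤-trans j<F (m≤m+n _ _) , low j<F (R-upper⊆R i (+ j) r)

child⇒Child : ∀ {i x u} → u < F (4 + i) → Block (1 + i) u x → ∃ (Child i x u)
child⇒Child {i} u<F (high r) = _ , upper (+-cancelˡ-< (F (3 + i)) _ _ u<F) r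
child⇒Child {i} {u = u} _ (low u<F r) with u <? F (1 + i)
... | yes u<F′ = _ , kept u<F′ r
... | no u≮F′ with m≤n⇒∃[o]m+o≡n (≮⇒≥ u≮F′)
...   | j , refl = _ , lower j<F r
  where
  j<F : j < F (2 + i)
  j<F = +-cancelˡ-< (F (1 + i)) _ _ (subst (F (1 + i) + j <_) (+-comm (F (2 + i)) (F (1 + i))) u<F)

parent⇒Child : ∀ {i x t} → t < F (3 + i) → Block i t x → ∃ λ u → Child i x u t
parent⇒Child {i} t<F (high r) = _ , kept (+-cancelˡ-< (F (2 + i)) _ _ t<F) r
parent⇒Child {i} {t = t} _ (low t<F r) with R-split i t r
... | inj₁ r′ = _ , lower t<F r′
... | inj₂ r′ = _ , upper t<F r′

Child-unique : ∀ {i x u u′ t t′} → Child i x u t → Child i x u′ t′ → t ≡ t′ → u ≡ u′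
Child-unique {i} (kept _ _) (kept _ _) e = +-cancelˡ-≡ (F (2 + i)) _ _ e
Child-unique (kept _ _) (lower j<F _) e = contradiction e (m+n≢o j<F)
Child-unique (kept _ _) (upper j<F _) e = contradiction e (m+n≢o j<F)
Child-unique (lower j<F _) (kept _ _) e = contradiction (sym e) (m+n≢o j<F)
Child-unique (upper j<F _) (kept _ _) e = contradiction (sym e) (m+n≢o j<F)
Child-unique (lower _ _) (lower _ _) refl = refl
Child-unique (upper _ _) (upper _ _) refl = refl
Child-unique {i} (lower {j} _ r) (upper _ r′) refl = ⊥-elim (R-split-disjoint i j r r′)
Child-unique {i} (upper {j} _ r′) (lower _ r) refl = ⊥-elim (R-split-disjoint i j r r′)

f-0-0≡a : ∀ n → f 0 (+ 0) n ≡ + a n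
f-0-0≡a n = cong +_ (trans (+-identityʳ _) (trans (+-identityʳ _) (*-identityˡ (a n))))

f-1-0≡b : ∀ n → f 1 (+ 0) n ≡ + b n
f-1-0≡b n = cong +_ (identity (a n) n)
  where
  identity : ∀ A n → (1 * A + 1 * n) + 0 ≡ A + n
  identity = solve-∀

R₀₀-R₁₀-disjoint : ∀ {x} → R 0 (+ 0) x → R 1 (+ 0) x → ⊥
R₀₀-R₁₀-disjoint (n , _ , refl) (m , m≥1 , e) =
  beatty-disjoint n m≥1 (ℤP.+-injective (trans (sym (f-0-0≡a n)) (trans e (f-1-0≡b m))))

covers : ∀ i → Covers i
covers zero (+≤+ n≥1) with beatty-cover n≥1
... | inj₁ (m , m≥1 , refl) = 0 , s≤s z≤n , low (s≤s z≤n) (m , m≥1 , sym (f-0-0≡a m))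
... | inj₂ (m , m≥1 , refl) = 1 , ≤-refl , high (m , m≥1 , sym (f-1-0≡b m))
covers (suc i) x>0 with covers i x>0
... | t , t<F , b with parent⇒Child t<F b
...   | u , c = u , Child⇒child c

disjoint : ∀ i → Disjoint i
disjoint zero _ _ (low (s≤s z≤n) _) (low (s≤s z≤n) _) = refl
disjoint zero (s≤s (s≤s z≤n)) (s≤s (s≤s z≤n)) (high _) (high _) = refl
disjoint zero _ (s≤s (s≤s z≤n)) (low (s≤s z≤n) r) (high r′) = ⊥-elim (R₀₀-R₁₀-disjoint r r′)
disjoint zero (s≤s (s≤s z≤n)) _ (high r′) (low (s≤s z≤n) r) = ⊥-elim (R₀₀-R₁₀-disjoint r r′)
disjoint (suc i) u<F u′<F b b′ with child⇒Child u<F b | child⇒Child u′<F b′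
... | _ , c | _ , c′ with Child⇒parent c | Child⇒parent c′
...   | t<F , p | t′<F , p′ = Child-unique c c′ (disjoint i t<F t′<F p p′)

Part-nonempty : ∀ i (t : Fin (F (3 + i))) → ∃ (Part (3 + i) t)
Part-nonempty i t with toℕ t <? F (2 + i)
... | yes _ = _ , 1 , ≤-refl , refl
... | no _ = _ , 1 , ≤-refl , refl

trivial-partition : IsPartitionOfℕ {1} (λ _ → Pos)
trivial-partition =
  (λ _ → + 1 , +≤+ ≤-refl) ,
  (λ _ _ x>0 → x>0) ,
  (λ { zero zero _ _ _ → refl }) ,
  (λ _ x>0 → zero , x>0)

theorem3p2 : (k : ℕ) → 1 ≤ k → IsPartitionOfℕ (Part k)
theorem3p2 1 _ = trivial-partition
theorem3p2 2 _ = trivial-partition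
theorem3p2 (suc (suc (suc i))) _ = Part-nonempty i , positive , disjoint′ , covers′
  where
  positive : ∀ t x → Part (3 + i) t x → Pos x
  positive t x p = Block-pos i (toℕ<n t) (Part⇒Block i t p)

  disjoint′ : ∀ t u x → Part (3 + i) t x → Part (3 + i) u x → t ≡ u
  disjoint′ t u x p q =
    toℕ-injective (disjoint i (toℕ<n t) (toℕ<n u) (Part⇒Block i t p) (Part⇒Block i u q))

  covers′ : ∀ x → Pos x → ∃ λ t → Part (3 + i) t x
  covers′ x x>0 with covers i x>0
  ... | t , t<F , b =
    fromℕ< t<F , Block⇒Part i _ (subst (λ v → Block i v x) (sym (toℕ-fromℕ< t<F)) b)
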